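{- Let $(\varphi,\varphi^*)$ be an $(m,n)$-reciprocal pair of skew-morphisms, $\varphi\colon\mathbb{Z}_n\to\mathbb{Z}_n$, $\varphi^*\colon\mathbb{Z}_m\to\mathbb{Z}_m$, with power functions $\pi(x)=-{\varphi^*}^{ -x}(-1)$ and $\pi^*(y)=-\varphi^{ -y}(-1)$. Then for every $x\in\{0,1,\dots,n-1\}$ and every $y\in\{0,1,\dots,m-1\}$, \[\varphi(x)\equiv\sum_{i=1}^x\pi^*({\varphi^*}^{ -i}(-1))\pmod{|\varphi^*|}\quad\text{and}\quad \varphi^*(y)\equiv\sum_{i=1}^y\pi(\varphi^{ -i}(-1))\pmod{|\varphi|}.\]
   Context: A skew-morphism of a finite group $A$ is a bijection $\varphi\colon A\to A$ fixing the identity with a function $\pi\colon A\to\mathbb{Z}$ (power function) such that $\varphi(xy)=\varphi(x)\varphi^{\pi(x)}(y)$ for all $x,y$. A pair $(\varphi,\varphi^*)$ of skew-morphisms of $\mathbb{Z}_n$ and $\mathbb{Z}_m$ is $(m,n)$-reciprocal if $|\varphi|$ divides $m$, $|\varphi^*|$ divides $n$, and $\pi(x)=-{\varphi^*}^{ -x}(-1)$ and $\pi^*(y)=-\varphi^{ -y}(-1)$ are power functions for $\varphi$ and $\varphi^*$, respectively. Note $\varphi(x)\in\mathbb{Z}_n$ is reduced modulo $|\varphi^*|$, which divides $n$, and similarly for $\varphi^*(y)$. -}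

module Defs where

open import Data.Nat as ℕ using (ℕ; zero; suc; NonZero; _∸_; _<_)
open import Data.Nat.DivMod using (_mod_)
open import Data.Nat.Divisibility using () renaming (_∣_ to _∣ℕ_)
open import Data.Integer as ℤ using (ℤ; +_; -[1+_]; -_; _-_)
open import Data.Integer.Divisibility using (_∣_)
open import Data.Fin using (Fin; toℕ)
open import Data.Fin.Permutation using (Permutation′; _⟨$⟩ʳ_; _⟨$⟩ˡ_)
open import Data.Product using (_×_)
open import Relation.Binary.PropositionalEquality using (_≡_)
open import Relation.Nullary using (¬_)

-- The cyclic group ℤ_n, represented by Fin n (residues 0..n-1), n ≥ 1.
module _ (n : ℕ) .{{_ : NonZero n}} where

  zeroₙ : Fin n
  zeroₙ = 0 mod n

  minusOneₙ : Fin n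
  minusOneₙ = (n ∸ 1) mod n

  addₙ : Fin n → Fin n → Fin n
  addₙ x y = (toℕ x ℕ.+ toℕ y) mod n

iterℕ : ∀ {A : Set} → (A → A) → ℕ → A → A
iterℕ f zero    a = a
iterℕ f (suc k) a = f (iterℕ f k a)

pow : ∀ {n} → Permutation′ n → ℤ → Fin n → Fin n
pow φ (+ k)      = iterℕ (φ ⟨$⟩ʳ_) k
pow φ -[1+ k ]   = iterℕ (φ ⟨$⟩ˡ_) (suc k)

IsOrder : ∀ {n} → Permutation′ n → ℕ → Set
IsOrder {n} φ k =
  (0 < k) × (∀ x → pow φ (+ k) x ≡ x)
  × (∀ j → 0 < j → j < k → ¬ (∀ (x : Fin n) → pow φ (+ j) x ≡ x))

IsSkewMorphism : (n : ℕ) .{{_ : NonZero n}} → Permutation′ n → (Fin n → ℤ) → Set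
IsSkewMorphism n φ π =
  (φ ⟨$⟩ʳ zeroₙ n ≡ zeroₙ n)
  × (∀ x y → φ ⟨$⟩ʳ addₙ n x y ≡ addₙ n (φ ⟨$⟩ʳ x) (pow φ (π x) y))

-- The power function determined by the partner:  π(x) = - ψ^{-x}(-1),
-- where ψ is a permutation of ℤ_m and x ∈ ℤ_n, ψ^{-x}(-1) ∈ ℤ_m taken as its
-- residue in {0,…,m-1}.
recipPower : ∀ {n} (m : ℕ) .{{_ : NonZero m}} → Permutation′ m → Fin n → ℤ
recipPower m ψ x = - (+ toℕ (pow ψ (- (+ toℕ x)) (minusOneₙ m)))

IsReciprocal : (m n : ℕ) .{{_ : NonZero m}} .{{_ : NonZero n}} →
               Permutation′ n → Permutation′ m → Set
IsReciprocal m n φ φ* =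
  (∀ k → IsOrder φ k → k ∣ℕ m)
  × (∀ k → IsOrder φ* k → k ∣ℕ n)
  × IsSkewMorphism n φ (recipPower m φ*)
  × IsSkewMorphism m φ* (recipPower n φ)

sum1 : ℕ → (ℕ → ℤ) → ℤ
sum1 zero    f = + 0
sum1 (suc x) f = sum1 x f ℤ.+ f (suc x)

_≡_[mod_] : ℤ → ℤ → ℕ → Set
a ≡ b [mod k ] = (+ k) ∣ (a - b)

-- Putting y = -1 in the skew-morphism identity gives φ(x - 1) = φ(x) + φ^{π(x)}(-1) in ℤ_n, so
-- descending from φ(0) = 0 yields φ(x) ≡ - Σ_{i=1}^{x} φ^{π(i)}(-1) (mod n) for every
-- skew-morphism. For a reciprocal pair π(i) = -φ*^{-i}(-1), so the summand -φ^{π(i)}(-1) is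
-- literally π*(φ*^{-i}(-1)), and the congruence descends from n to its divisor |φ*|.
module Submission where

open import Defs
open import Data.Nat using (ℕ; NonZero; zero; suc; _<_; _∸_; _%_; _/_)
import Data.Nat as ℕ using (_*_; _+_)
import Data.Nat.Properties as ℕₚ
open import Data.Nat.DivMod using (m%n<n; m≡m%n+[m/n]*n; [m+n]%n≡m%n; m<n⇒m%n≡m)
open import Data.Nat.Divisibility using (divides; ∣-trans) renaming (_∣_ to _∣ℕ_)
open import Data.Integer using (ℤ; +_; -_; _+_; _-_; ∣_∣)
import Data.Integer.Properties as ℤₚ
import Data.Integer.Divisibility.Signed as Signed
open import Data.Integer.Tactic.RingSolver using (solve-∀)
open import Data.Fin using (Fin; toℕ; fromℕ<)
open import Data.Fin.Properties using (toℕ-fromℕ<; fromℕ<-cong; fromℕ<-toℕ; toℕ<n)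
open import Data.Fin.Permutation using (Permutation′; _⟨$⟩ʳ_)
open import Data.Product using (_×_; _,_; proj₁; proj₂)
open import Relation.Binary.PropositionalEquality

%-≡-mod : (x n : ℕ) .{{_ : NonZero n}} → (+ (x % n)) ≡ (+ x) [mod n ]
%-≡-mod x n = divides (x / n) (begin
  ∣ r - + x ∣      ≡⟨ cong (λ t → ∣ r - t ∣) x≡r+qn ⟩
  ∣ r - (r + c) ∣  ≡⟨ cong ∣_∣ (cancel r c) ⟩
  ∣ - c ∣          ≡⟨ ℤₚ.∣-i∣≡∣i∣ c ⟩
  x / n ℕ.* n      ∎)
  where
  open ≡-Reasoning
  r c : ℤ
  r = + (x % n)
  c = + (x / n ℕ.* n)
  x≡r+qn : + x ≡ r + c
  x≡r+qn = trans (cong +_ (m≡m%n+[m/n]*n x n)) (ℤₚ.pos-+ (x % n) (x / n ℕ.* n))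
  cancel : ∀ a b → a - (a + b) ≡ - b
  cancel = solve-∀

≡-mod-subtract : ∀ {n} a b d s → a ≡ s [mod n ] → a ≡ b + d [mod n ] → b ≡ s - d [mod n ]
≡-mod-subtract {n} a b d s a≡s a≡b+d =
  Signed.∣⇒∣ᵤ (subst (+ n Signed.∣_) (rearrange a b d s)
    (Signed.∣m∣n⇒∣m-n (Signed.∣ᵤ⇒∣ {i = a - s} a≡s) (Signed.∣ᵤ⇒∣ {i = a - (b + d)} a≡b+d)))
  where
  rearrange : ∀ a b d s → (a - s) - (a - (b + d)) ≡ b - (s - d)
  rearrange = solve-∀

toℕ-addₙ : ∀ {n} .{{_ : NonZero n}} (x y : Fin n) → (+ toℕ (addₙ n x y)) ≡ (+ toℕ x + + toℕ y) [mod n ]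
toℕ-addₙ {n} x y rewrite toℕ-fromℕ< (m%n<n (toℕ x ℕ.+ toℕ y) n) | sym (ℤₚ.pos-+ (toℕ x) (toℕ y)) =
  %-≡-mod (toℕ x ℕ.+ toℕ y) n

toℕ-minusOneₙ : ∀ n .{{_ : NonZero n}} → toℕ (minusOneₙ n) ≡ n ∸ 1
toℕ-minusOneₙ (suc n) = trans (toℕ-fromℕ< _) (m<n⇒m%n≡m (ℕₚ.n<1+n n))

suc-+-pred : ∀ k n .{{_ : NonZero n}} → suc k ℕ.+ (n ∸ 1) ≡ k ℕ.+ n
suc-+-pred k (suc n) = sym (ℕₚ.+-suc k n)

fromℕ<-zero≡zeroₙ : ∀ {n} .{{_ : NonZero n}} (0<n : 0 < n) → fromℕ< 0<n ≡ zeroₙ n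
fromℕ<-zero≡zeroₙ {n} 0<n = fromℕ<-cong 0 (0 % n) (sym (m<n⇒m%n≡m 0<n)) 0<n (m%n<n 0 n)

addₙ-fromℕ<-minusOneₙ : ∀ {n} .{{_ : NonZero n}} {k} (k+1<n : suc k < n) →
  addₙ n (fromℕ< k+1<n) (minusOneₙ n) ≡ fromℕ< (ℕₚ.<⇒≤ k+1<n)
addₙ-fromℕ<-minusOneₙ {n} {k} k+1<n = fromℕ<-cong _ k sum≡k _ (ℕₚ.<⇒≤ k+1<n)
  where
  open ≡-Reasoning
  sum≡k : (toℕ (fromℕ< k+1<n) ℕ.+ toℕ (minusOneₙ n)) % n ≡ k
  sum≡k = begin
    (toℕ (fromℕ< k+1<n) ℕ.+ toℕ (minusOneₙ n)) % n
      ≡⟨ cong₂ (λ a b → (a ℕ.+ b) % n) (toℕ-fromℕ< k+1<n) (toℕ-minusOneₙ n) ⟩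
    (suc k ℕ.+ (n ∸ 1)) % n  ≡⟨ cong (_% n) (suc-+-pred k n) ⟩
    (k ℕ.+ n) % n            ≡⟨ [m+n]%n≡m%n k n ⟩
    k % n                    ≡⟨ m<n⇒m%n≡m (ℕₚ.<⇒≤ k+1<n) ⟩
    k                        ∎

module SkewMorphism {n} .{{_ : NonZero n}} (φ : Permutation′ n) (π : Fin n → ℤ)
                    (skew : IsSkewMorphism n φ π) where

  φ-fromℕ<-pred : ∀ {k} (k+1<n : suc k < n) →
    (+ toℕ (φ ⟨$⟩ʳ fromℕ< (ℕₚ.<⇒≤ k+1<n)))
      ≡ (+ toℕ (φ ⟨$⟩ʳ fromℕ< k+1<n) + + toℕ (pow φ (π (fromℕ< k+1<n)) (minusOneₙ n))) [mod n ]
  φ-fromℕ<-pred k+1<n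
    rewrite sym (addₙ-fromℕ<-minusOneₙ k+1<n) | proj₂ skew (fromℕ< k+1<n) (minusOneₙ n) =
    toℕ-addₙ (φ ⟨$⟩ʳ fromℕ< k+1<n) (pow φ (π (fromℕ< k+1<n)) (minusOneₙ n))

  module _ (g : ℕ → ℤ) (g-step : ∀ x → g (toℕ x) ≡ - (+ toℕ (pow φ (π x) (minusOneₙ n)))) where

    φ-fromℕ<≡sum : ∀ {k} (k<n : k < n) → (+ toℕ (φ ⟨$⟩ʳ fromℕ< k<n)) ≡ sum1 k g [mod n ]
    φ-fromℕ<≡sum {zero} 0<n
      rewrite fromℕ<-zero≡zeroₙ 0<n | proj₁ skew | toℕ-fromℕ< (m%n<n 0 n) = %-≡-mod 0 n
    φ-fromℕ<≡sum {suc k} k+1<n =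
      subst (λ t → φₖ₊₁ ≡ sum1 k g + t [mod n ]) (sym g-step′)
        (≡-mod-subtract φₖ φₖ₊₁ step (sum1 k g) (φ-fromℕ<≡sum k<n) (φ-fromℕ<-pred k+1<n))
      where
      k<n : k < n
      k<n = ℕₚ.<⇒≤ k+1<n
      φₖ φₖ₊₁ step : ℤ
      φₖ = + toℕ (φ ⟨$⟩ʳ fromℕ< k<n)
      φₖ₊₁ = + toℕ (φ ⟨$⟩ʳ fromℕ< k+1<n)
      step = + toℕ (pow φ (π (fromℕ< k+1<n)) (minusOneₙ n))
      g-step′ : g (suc k) ≡ - step
      g-step′ = trans (cong g (sym (toℕ-fromℕ< k+1<n))) (g-step (fromℕ< k+1<n))

    φ≡sum : ∀ x → (+ toℕ (φ ⟨$⟩ʳ x)) ≡ sum1 (toℕ x) g [mod n ]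
    φ≡sum x = subst (λ z → (+ toℕ (φ ⟨$⟩ʳ z)) ≡ sum1 (toℕ x) g [mod n ])
                    (fromℕ<-toℕ x (toℕ<n x)) (φ-fromℕ<≡sum (toℕ<n x))

    φ≡sum-mod-divisor : ∀ {d} → d ∣ℕ n → ∀ x → (+ toℕ (φ ⟨$⟩ʳ x)) ≡ sum1 (toℕ x) g [mod d ]
    φ≡sum-mod-divisor d∣n x = ∣-trans d∣n (φ≡sum x)

corollary1 : (m n : ℕ) .{{_ : NonZero m}} .{{_ : NonZero n}}
    → (φ : Permutation′ n) (φ* : Permutation′ m)
    → IsReciprocal m n φ φ*
    → (ordφ ordφ* : ℕ) → IsOrder φ ordφ → IsOrder φ* ordφ*
    → (∀ (x : Fin n) → (+ toℕ (φ ⟨$⟩ʳ x)) ≡ sum1 (toℕ x) (λ i → recipPower n φ (pow φ* (- (+ i)) (minusOneₙ m))) [mod ordφ* ])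
    × (∀ (y : Fin m) → (+ toℕ (φ* ⟨$⟩ʳ y)) ≡ sum1 (toℕ y) (λ i → recipPower m φ* (pow φ (- (+ i)) (minusOneₙ n))) [mod ordφ ])
corollary1 m n φ φ* (ordφ∣m , ordφ*∣n , φ-skew , φ*-skew) ordφ ordφ* φ-order φ*-order =
  SkewMorphism.φ≡sum-mod-divisor φ (recipPower m φ*) φ-skew _ (λ _ → refl) (ordφ*∣n ordφ* φ*-order) ,
  SkewMorphism.φ≡sum-mod-divisor φ* (recipPower n φ) φ*-skew _ (λ _ → refl) (ordφ∣m ordφ φ-order)
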